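{- Let $A_0A_1\dots A_n$ be a lattice oriented broken line on unit distance from a lattice point $V_1$ and $B_0B_1\dots B_n$ a lattice oriented broken line on unit distance from a lattice point $V_2$. Their signed length-sine sequences (relative to $V_1$ and $V_2$ respectively) coincide if and only if there exists a proper lattice-affine transformation $\xi$ with $\xi(V_1)=V_2$ and $\xi(A_i)=B_i$ for all $i=0,\dots,n$.
   Context: We work in $\mathbb R^2$ with standard orientation and lattice $\mathbb Z^2$. A proper lattice-affine transformation is $x\mapsto Mx+b$ with $M\in GL_2(\mathbb Z)$, $\det M=1$, $b\in\mathbb Z^2$. For distinct lattice points $A,B$, $\operatorname{l\ell}(AB)$ is the number of lattice points on segment $AB$ minus one. $\operatorname{sgn}(A,B,C)\in\{1,0,-1\}$ is the sign of $\det(A-B,C-B)$. For an ordinary lattice angle $\angle XOY$ (lattice points, not collinear), let $v_1,v_2$ be primitive lattice vectors along $OX$, $OY$; the lattice points $P$ with $(v_1,P-O)$ a basis form two lines parallel to $OX$; ray $OY$ meets exactly one, $l$, at $Q$; let $D$ be the lattice point of $l$ nearest $Q$ among those strictly on the other side of line $OY$ from $X$; writing $v_2=x_1v_1+x_2(D-O)$, $\operatorname{lsin}\angle XOY=x_2$. A lattice oriented broken line $A_0A_1\dots A_n$ ($n\ge1$) is a sequence of lattice points with $A_{i-1}\ne A_i$ and no two consecutive segments contained in a common line. It is on unit distance from a lattice point $V$ if for every $i$ the primitive lattice vector along $A_{i-1}A_i$ and $V-A_{i-1}$ form a basis of $\mathbb Z^2$. Its signed length-sine sequence relative to $V$ is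 $(a_0,\dots,a_{2n-2})$ with $a_{2i-2}=\operatorname{sgn}(A_{i-1},V,A_i)\operatorname{l\ell}(A_{i-1}A_i)$ ($1\le i\le n$) and $a_{2i-1}=\operatorname{sgn}(A_{i-1},V,A_i)\operatorname{sgn}(A_i,V,A_{i+1})\operatorname{sgn}(A_{i-1},A_i,A_{i+1})\operatorname{lsin}\angle A_{i-1}A_iA_{i+1}$ ($1\le i\le n-1$). -}

module Defs where

open import Data.Nat as ℕ using (ℕ; zero; suc)
open import Data.Integer as ℤ using (ℤ; +_; -[1+_]; _+_; _-_; _*_; -_; ∣_∣; _≤_)
open import Data.Product using (Σ; ∃; ∃₂; _×_; _,_)
open import Data.List using (List; length)
open import Data.List.Membership.Propositional using (_∈_)
open import Data.List.Relation.Unary.Unique.Propositional using (Unique)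
open import Relation.Binary.PropositionalEquality using (_≡_; _≢_)

Pt : Set
Pt = ℤ × ℤ

origin : Pt
origin = (+ 0 , + 0)

_⊕_ : Pt → Pt → Pt
(a , b) ⊕ (c , d) = (a + c , b + d)

_⊖_ : Pt → Pt → Pt
(a , b) ⊖ (c , d) = (a - c , b - d)

_·_ : ℤ → Pt → Pt
k · (a , b) = (k * a , k * b)

infixl 6 _⊕_ _⊖_
infixl 7 _·_

det : Pt → Pt → ℤ
det (a , b) (c , d) = a * d - b * c

dot : Pt → Pt → ℤ
dot (a , b) (c , d) = a * c + b * d

norm² : Pt → ℤ
norm² v = dot v v

sgnℤ : ℤ → ℤ
sgnℤ (+ zero) = + 0
sgnℤ (+ suc _) = + 1
sgnℤ -[1+ _ ] = - (+ 1)

sgn : Pt → Pt → Pt → ℤ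
sgn A B C = sgnℤ (det (A ⊖ B) (C ⊖ B))

IsBasis : Pt → Pt → Set
IsBasis u w =
  (∀ z → ∃₂ λ a b → z ≡ a · u ⊕ b · w) ×
  (∀ a b → a · u ⊕ b · w ≡ origin → (a ≡ + 0) × (b ≡ + 0))

Primitive : Pt → Set
Primitive v = ∀ (m : ℤ) (w : Pt) → v ≡ m · w → ∣ m ∣ ≡ 1

PrimAlong : Pt → Pt → Pt → Set
PrimAlong P X v = Primitive v × ∃ λ (k : ℕ) → X ⊖ P ≡ (+ suc k) · v

OnSeg : Pt → Pt → Pt → Set
OnSeg A B P =
  (det (B ⊖ A) (P ⊖ A) ≡ + 0) × (+ 0 ≤ dot (P ⊖ A) (B ⊖ A)) × (dot (P ⊖ A) (B ⊖ A) ≤ norm² (B ⊖ A))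

-- LL A B m : lℓ(AB) = m, i.e. the segment AB contains exactly m+1 lattice points
LL : Pt → Pt → ℕ → Set
LL A B m = ∃ λ (L : List Pt) →
  Unique L × (length L ≡ suc m) × (∀ P → (P ∈ L → OnSeg A B P) × (OnSeg A B P → P ∈ L))

OtherSide : Pt → Pt → Pt → Pt → Set
OtherSide O v2 X D = sgnℤ (det v2 (D ⊖ O)) * sgnℤ (det v2 (X ⊖ O)) ≡ - (+ 1)

-- LSin O X Y x₂ : lsin ∠XOY = x₂, following the construction in the paper.
-- v1, v2 primitive along OX, OY; D a lattice point with (v1, D-O) a basis, so D lies on one of the
-- two lines parallel to OX; the line l through D parallel to OX meets the ray OY at
-- Q = O + (p/q) v2 (p,q > 0); D is strictly on the other side of OY from X and is nearest to Q
-- among such lattice points of l (distances compared after scaling by q);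
-- and v2 = x₁ v1 + x₂ (D - O).
LSin : Pt → Pt → Pt → ℤ → Set
LSin O X Y x₂ =
  Σ Pt λ v1 → Σ Pt λ v2 → Σ Pt λ D → Σ ℕ λ p → Σ ℕ λ q → Σ ℤ λ x₁ →
    PrimAlong O X v1 × PrimAlong O Y v2 ×
    IsBasis v1 (D ⊖ O) ×
    ((+ suc p) * det v1 v2 ≡ (+ suc q) * det v1 (D ⊖ O)) ×
    OtherSide O v2 X D ×
    (∀ D' → IsBasis v1 (D' ⊖ O) → det v1 (D' ⊖ D) ≡ + 0 → OtherSide O v2 X D' →
       norm² ((+ suc q) · (D ⊖ O) ⊖ (+ suc p) · v2)
         ≤ norm² ((+ suc q) · (D' ⊖ O) ⊖ (+ suc p) · v2)) ×
    (v2 ≡ x₁ · v1 ⊕ x₂ · (D ⊖ O))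

BrokenLine : ℕ → (ℕ → Pt) → Set
BrokenLine n A =
  (1 ℕ.≤ n) ×
  (∀ i → i ℕ.< n → A i ≢ A (suc i)) ×
  (∀ i → suc i ℕ.< n → det (A (suc i) ⊖ A i) (A (suc (suc i)) ⊖ A (suc i)) ≢ + 0)

UnitDist : ℕ → (ℕ → Pt) → Pt → Set
UnitDist n A V = ∀ i → i ℕ.< n →
  ∃ λ v → PrimAlong (A i) (A (suc i)) v × IsBasis v (V ⊖ A i)

-- SLS n A V a : (a 0, …, a (2n-2)) is the signed length-sine sequence of A 0 … A n relative to V
SLS : ℕ → (ℕ → Pt) → Pt → (ℕ → ℤ) → Set
SLS n A V a =
  (∀ i → i ℕ.< n → ∃ λ ℓ → LL (A i) (A (suc i)) ℓ ×
     (a (2 ℕ.* i) ≡ sgn (A i) V (A (suc i)) * + ℓ)) ×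
  (∀ i → suc i ℕ.< n → ∃ λ s → LSin (A (suc i)) (A i) (A (suc (suc i))) s ×
     (a (suc (2 ℕ.* i)) ≡
        sgn (A i) V (A (suc i)) * sgn (A (suc i)) V (A (suc (suc i)))
          * sgn (A i) (A (suc i)) (A (suc (suc i))) * s))

record Aff : Set where
  constructor aff
  field
    m₁₁ m₁₂ m₂₁ m₂₂ b₁ b₂ : ℤ

apply : Aff → Pt → Pt
apply (aff m₁₁ m₁₂ m₂₁ m₂₂ b₁ b₂) (x , y) = (m₁₁ * x + m₁₂ * y + b₁ , m₂₁ * x + m₂₂ * y + b₂)

Proper : Aff → Set
Proper (aff m₁₁ m₁₂ m₂₁ m₂₂ _ _) = m₁₁ * m₂₂ - m₁₂ * m₂₁ ≡ + 1

{-# OPTIONS --safe #-}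
module Submission where

-- For a segment A_i A_{i+1} at unit distance from V, its signed lattice length is the determinant
-- det (A_{i+1} - A_i, V - A_i), and the signed lattice sine at A_{i+1} times the two neighbouring
-- entries is det (A_i - A_{i+1}, A_{i+2} - A_{i+1}). So the sequence records exactly these
-- determinants, which proper lattice-affine maps preserve. Conversely, if they agree, the first
-- segments give unimodular frames (primitive edge vector, V - A_0) of equal determinant, hence a
-- proper map sending one to the other, and each further vertex is pinned down by its two
-- determinants against the previous vertex and V.

open import Defs

-- Integer arithmetic is opened only inside this module, so that _*_ in the theorem below is ℕ's.
module BrokenLineCongruence where

  open import Data.Nat as ℕ using (ℕ; zero; suc; s≤s; z≤n; _<_; _≤_; _∸_)
  import Data.Nat.Properties as ℕP
  open import Data.Integer as ℤ using (ℤ; +_; -[1+_]; -1ℤ; _+_; _-_; _*_; -_; ∣_∣; +≤+)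
  import Data.Integer.Properties as ℤP
  open import Data.Integer.Tactic.RingSolver using (solve-∀)
  open import Data.Product using (∃; _×_; _,_; proj₁; proj₂)
  open import Data.Sum using ([_,_]′)
  open import Data.Empty using (⊥-elim)
  open import Function.Base using (id)
  open import Data.List using (List; map; upTo; length)
  open import Data.List.Relation.Unary.Unique.Propositional using (Unique)
  open import Data.List.Properties using (length-map; length-upTo)
  open import Data.List.Membership.Propositional using (_∈_)
  open import Data.List.Membership.Propositional.Properties using (∈-map⁺; ∈-map⁻; ∈-upTo⁺; ∈-upTo⁻)
  open import Data.List.Membership.Propositional.Properties.WithK using (unique∧set⇒bag)
  open import Data.List.Relation.Unary.Unique.Propositional.Properties using (map⁺; upTo⁺)
  open import Data.List.Relation.Binary.BagAndSetEquality using (∼bag⇒↭)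
  open import Data.List.Relation.Binary.Permutation.Propositional.Properties using (↭-length)
  open import Function.Bundles using (_⇔_; mk⇔; Equivalence)
  open import Relation.Binary.PropositionalEquality hiding ([_])
  open ≡-Reasoning

  data IsUnit : ℤ → Set where
    one       : IsUnit (+ 1)
    minus-one : IsUnit -1ℤ

  unit*unit≡1 : ∀ {e} → IsUnit e → e * e ≡ + 1
  unit*unit≡1 one       = refl
  unit*unit≡1 minus-one = refl

  unit≢0 : ∀ {e} → IsUnit e → e ≢ + 0
  unit≢0 one       ()
  unit≢0 minus-one ()

  neg-unit : ∀ {e} → IsUnit e → IsUnit (- e)
  neg-unit one       = minus-one
  neg-unit minus-one = one

  ∣i∣≡1⇒unit : ∀ {i} → ∣ i ∣ ≡ 1 → IsUnit i
  ∣i∣≡1⇒unit {+ .1}          refl = one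
  ∣i∣≡1⇒unit { -[1+ zero ]}  _    = minus-one
  ∣i∣≡1⇒unit { -[1+ suc _ ]} ()

  i*j≡1⇒unit : ∀ i j → i * j ≡ + 1 → IsUnit i
  i*j≡1⇒unit i j ij≡1 =
    ∣i∣≡1⇒unit (ℕP.m*n≡1⇒m≡1 ∣ i ∣ ∣ j ∣ (trans (sym (ℤP.abs-* i j)) (cong ∣_∣ ij≡1)))

  sgn-positive*unit : ∀ c {e} → .{{ℤ.Positive c}} → IsUnit e → sgnℤ (c * e) ≡ e
  sgn-positive*unit (+ suc _) one       = refl
  sgn-positive*unit (+ suc _) minus-one = refl

  ∣+suc*unit∣ : ∀ k {e} → IsUnit e → ∣ + suc k * e ∣ ≡ suc k
  ∣+suc*unit∣ k {e} unit = begin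
    ∣ + suc k * e ∣     ≡⟨ ℤP.abs-* (+ suc k) e ⟩
    suc k ℕ.* ∣ e ∣     ≡⟨ cong (suc k ℕ.*_) (∣unit∣ unit) ⟩
    suc k ℕ.* 1         ≡⟨ ℕP.*-identityʳ (suc k) ⟩
    suc k               ∎
    where
    ∣unit∣ : ∀ {e} → IsUnit e → ∣ e ∣ ≡ 1
    ∣unit∣ one       = refl
    ∣unit∣ minus-one = refl

  i*i≡+∣i∣*∣i∣ : ∀ i → i * i ≡ + (∣ i ∣ ℕ.* ∣ i ∣)
  i*i≡+∣i∣*∣i∣ (+ n)    = ℤP.+◃n≡+n _
  i*i≡+∣i∣*∣i∣ -[1+ n ] = ℤP.+◃n≡+n _

  ∣i∣*∣i∣≡0⇒i≡0 : ∀ i → ∣ i ∣ ℕ.* ∣ i ∣ ≡ 0 → i ≡ + 0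
  ∣i∣*∣i∣≡0⇒i≡0 i ii≡0 = ℤP.∣i∣≡0⇒i≡0 ([ id , id ]′ (ℕP.m*n≡0⇒m≡0∨n≡0 ∣ i ∣ ii≡0))

  *-cancelʳ-≢0 : ∀ {c} → c ≢ + 0 → ∀ {x y} → x * c ≡ y * c → x ≡ y
  *-cancelʳ-≢0 c≢0 {x} {y} = ℤP.*-cancelʳ-≡ x y _ {{ℤ.≢-nonZero c≢0}}

  *-≢0 : ∀ {i j} → i ≢ + 0 → j ≢ + 0 → i * j ≢ + 0
  *-≢0 {i} i≢0 j≢0 ij≡0 = [ i≢0 , j≢0 ]′ (ℤP.i*j≡0⇒i≡0∨j≡0 i ij≡0)

  +suc*i≡0⇒i≡0 : ∀ k {i} → + suc k * i ≡ + 0 → i ≡ + 0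
  +suc*i≡0⇒i≡0 k ki≡0 = [ (λ ()) , id ]′ (ℤP.i*j≡0⇒i≡0∨j≡0 (+ suc k) ki≡0)

  +suc*i≡+suc⇒positive : ∀ p q i → + suc p * i ≡ + suc q → ∃ λ m → i ≡ + suc m
  +suc*i≡+suc⇒positive p q (+ suc m) _  = m , refl
  +suc*i≡+suc⇒positive p q (+ zero)  eq with trans (sym (ℤP.*-zeroʳ (+ suc p))) eq
  ... | ()
  +suc*i≡+suc⇒positive p q -[1+ m ]  ()

  -- Plane vector algebra

  ⊖-⊕ : ∀ p q → (p ⊖ q) ⊕ q ≡ p
  ⊖-⊕ (a , b) (c , d) = cong₂ _,_ (lemma a c) (lemma b d)
    where
    lemma : ∀ a c → a - c + c ≡ a
    lemma = solve-∀

  ⊖-cancelʳ : ∀ {p q r} → p ⊖ q ≡ r ⊖ q → p ≡ r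
  ⊖-cancelʳ {p} {q} {r} eq = begin
    p             ≡⟨ sym (⊖-⊕ p q) ⟩
    (p ⊖ q) ⊕ q   ≡⟨ cong (_⊕ q) eq ⟩
    (r ⊖ q) ⊕ q   ≡⟨ ⊖-⊕ r q ⟩
    r             ∎

  ⊕-⊖ : ∀ p x → (p ⊕ x) ⊖ p ≡ x
  ⊕-⊖ (a , b) (c , d) = cong₂ _,_ (lemma a c) (lemma b d)
    where
    lemma : ∀ a c → a + c - a ≡ c
    lemma = solve-∀

  ⊖-swap : ∀ p q c v → q ⊖ p ≡ c · v → p ⊖ q ≡ c · (-1ℤ · v)
  ⊖-swap (a , b) (a' , b') c (x , y) eq =
    cong₂ _,_ (lemma a a' c x (cong proj₁ eq)) (lemma b b' c y (cong proj₂ eq))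
    where
    lemma : ∀ a a' c x → a' - a ≡ c * x → a - a' ≡ c * (-1ℤ * x)
    lemma a a' c x eq = trans (identity a a') (trans (cong -_ eq) (identity′ c x))
      where
      identity : ∀ a a' → a - a' ≡ - (a' - a)
      identity = solve-∀
      identity′ : ∀ c x → - (c * x) ≡ c * (-1ℤ * x)
      identity′ = solve-∀

  ·-assoc : ∀ a b x → a · (b · x) ≡ (a * b) · x
  ·-assoc a b (x , y) = cong₂ _,_ (lemma a b x) (lemma a b y)
    where
    lemma : ∀ a b x → a * (b * x) ≡ a * b * x
    lemma = solve-∀

  det-·ˡ : ∀ c u w → det (c · u) w ≡ c * det u w
  det-·ˡ c (a , b) (x , y) = lemma c a b x y
    where
    lemma : ∀ c a b x y → c * a * y - c * b * x ≡ c * (a * y - b * x)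
    lemma = solve-∀

  det-·ʳ : ∀ c u w → det u (c · w) ≡ c * det u w
  det-·ʳ c (a , b) (x , y) = lemma c a b x y
    where
    lemma : ∀ c a b x y → a * (c * y) - b * (c * x) ≡ c * (a * y - b * x)
    lemma = solve-∀

  det-self : ∀ u → det u u ≡ + 0
  det-self (a , b) = lemma a b
    where
    lemma : ∀ a b → a * b - b * a ≡ + 0
    lemma = solve-∀

  det-·ʳ-self : ∀ c u → det u (c · u) ≡ + 0
  det-·ʳ-self c u = begin
    det u (c · u)   ≡⟨ det-·ʳ c u u ⟩
    c * det u u     ≡⟨ cong (c *_) (det-self u) ⟩
    c * + 0         ≡⟨ ℤP.*-zeroʳ c ⟩
    + 0             ∎

  det-shear : ∀ u a b w → det u (a · u ⊕ b · w) ≡ b * det u w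
  det-shear (x , y) a b (z , t) = lemma x y a b z t
    where
    lemma : ∀ x y a b z t → x * (a * y + b * t) - y * (a * x + b * z) ≡ b * (x * t - y * z)
    lemma = solve-∀

  det-bilinear : ∀ a b c d u f → det (a · u ⊕ b · f) (c · u ⊕ d · f) ≡ (a * d - b * c) * det u f
  det-bilinear a b c d (u₁ , u₂) (f₁ , f₂) = lemma a b c d u₁ u₂ f₁ f₂
    where
    lemma : ∀ a b c d u₁ u₂ f₁ f₂ →
      (a * u₁ + b * f₁) * (c * u₂ + d * f₂) - (a * u₂ + b * f₂) * (c * u₁ + d * f₁)
        ≡ (a * d - b * c) * (u₁ * f₂ - u₂ * f₁)
    lemma = solve-∀

  cramer : ∀ u f w → det u f · w ≡ det w f · u ⊕ det u w · f
  cramer (a , b) (c , d) (e , g) = cong₂ _,_ (lemma₁ a b c d e g) (lemma₂ a b c d e g)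
    where
    lemma₁ : ∀ a b c d e g → (a * d - b * c) * e ≡ (e * d - g * c) * a + (a * g - b * e) * c
    lemma₁ = solve-∀
    lemma₂ : ∀ a b c d e g → (a * d - b * c) * g ≡ (e * d - g * c) * b + (a * g - b * e) * d
    lemma₂ = solve-∀

  ·-cancelˡ : ∀ {c} → c ≢ + 0 → ∀ {x y} → c · x ≡ c · y → x ≡ y
  ·-cancelˡ {c} c≢0 {a , b} {a' , b'} eq = cong₂ _,_
    (ℤP.*-cancelˡ-≡ c a a' {{ℤ.≢-nonZero c≢0}} (cong proj₁ eq))
    (ℤP.*-cancelˡ-≡ c b b' {{ℤ.≢-nonZero c≢0}} (cong proj₂ eq))

  det-injective : ∀ u f {w w'} → det u f ≢ + 0 →
    det u w ≡ det u w' → det w f ≡ det w' f → w ≡ w'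
  det-injective u f {w} {w'} nondegenerate uw≡uw' wf≡w'f = ·-cancelˡ nondegenerate (begin
    det u f · w                     ≡⟨ cramer u f w ⟩
    det w f · u ⊕ det u w · f       ≡⟨ cong₂ (λ a b → a · u ⊕ b · f) wf≡w'f uw≡uw' ⟩
    det w' f · u ⊕ det u w' · f     ≡⟨ sym (cramer u f w') ⟩
    det u f · w'                    ∎)

  basis⇒unit-det : ∀ {u f} → IsBasis u f → IsUnit (det u f)
  basis⇒unit-det {u} {f} (span , _) with span (+ 1 , + 0) | span (+ 0 , + 1)
  ... | a , b , e₁≡ | c , d , e₂≡ = i*j≡1⇒unit (det u f) (a * d - b * c) (begin
    det u f * (a * d - b * c)                 ≡⟨ ℤP.*-comm (det u f) _ ⟩
    (a * d - b * c) * det u f                 ≡⟨ sym (det-bilinear a b c d u f) ⟩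
    det (a · u ⊕ b · f) (c · u ⊕ d · f)       ≡⟨ sym (cong₂ det e₁≡ e₂≡) ⟩
    + 1                                       ∎)

  ·-cancelʳ-unimodular : ∀ u f → IsUnit (det u f) → ∀ {a b} → a · u ≡ b · u → a ≡ b
  ·-cancelʳ-unimodular u f unit {a} {b} eq = *-cancelʳ-≢0 (unit≢0 unit) (begin
    a * det u f       ≡⟨ sym (det-·ˡ a u f) ⟩
    det (a · u) f     ≡⟨ cong (λ x → det x f) eq ⟩
    det (b · u) f     ≡⟨ det-·ˡ b u f ⟩
    b * det u f       ∎)

  parallel⇒multiple : ∀ u f w → IsUnit (det u f) → det u w ≡ + 0 → w ≡ (det u f * det w f) · u
  parallel⇒multiple u f w unit uw≡0 = det-injective u f (unit≢0 unit)
    (begin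
      det u w                    ≡⟨ uw≡0 ⟩
      + 0                        ≡⟨ sym (det-·ʳ-self m u) ⟩
      det u (m · u)              ∎)
    (begin
      det w f                    ≡⟨ sym (ℤP.*-identityˡ (det w f)) ⟩
      + 1 * det w f              ≡⟨ cong (_* det w f) (sym (unit*unit≡1 unit)) ⟩
      ε * ε * det w f            ≡⟨ reorder ε (det w f) ⟩
      m * ε                      ≡⟨ sym (det-·ˡ m u f) ⟩
      det (m · u) f              ∎)
    where
    ε m : ℤ
    ε = det u f
    m = ε * det w f
    reorder : ∀ e d → e * e * d ≡ e * d * e
    reorder = solve-∀

  -- Lattice length

  norm²-positive : ∀ u f → IsUnit (det u f) → ∃ λ m → norm² u ≡ + suc m
  norm²-positive (a , b) (c , d) unit with ∣ a ∣ ℕ.* ∣ a ∣ ℕ.+ ∣ b ∣ ℕ.* ∣ b ∣ in norm≡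
  ... | suc m = m , (begin
    a * a + b * b                                     ≡⟨ cong₂ _+_ (i*i≡+∣i∣*∣i∣ a) (i*i≡+∣i∣*∣i∣ b) ⟩
    + (∣ a ∣ ℕ.* ∣ a ∣) + + (∣ b ∣ ℕ.* ∣ b ∣)         ≡⟨ sym (ℤP.pos-+ (∣ a ∣ ℕ.* ∣ a ∣) _) ⟩
    + (∣ a ∣ ℕ.* ∣ a ∣ ℕ.+ ∣ b ∣ ℕ.* ∣ b ∣)           ≡⟨ cong +_ norm≡ ⟩
    + suc m                                           ∎)
  ... | zero with ∣i∣*∣i∣≡0⇒i≡0 a (ℕP.m+n≡0⇒m≡0 _ norm≡) | ∣i∣*∣i∣≡0⇒i≡0 b (ℕP.m+n≡0⇒n≡0 _ norm≡)
  ...   | refl | refl = ⊥-elim (unit≢0 unit refl)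

  module SegmentPoints (P Q u f : Pt) (k : ℕ) (along : Q ⊖ P ≡ + suc k · u) (unit : IsUnit (det u f)) where

    private
      K N : ℤ
      K = + suc k
      N = + suc (proj₁ (norm²-positive u f unit))

    dot-along : ∀ t → dot (t · u) (Q ⊖ P) ≡ t * (K * N)
    dot-along t = begin
      dot (t · u) (Q ⊖ P)     ≡⟨ cong (dot (t · u)) along ⟩
      dot (t · u) (K · u)     ≡⟨ dot-· t K u ⟩
      t * (K * norm² u)       ≡⟨ cong (λ n → t * (K * n)) (proj₂ (norm²-positive u f unit)) ⟩
      t * (K * N)             ∎
      where
      dot-· : ∀ a b u → dot (a · u) (b · u) ≡ a * (b * norm² u)
      dot-· a b (x , y) = lemma a b x y
        where
        lemma : ∀ a b x y → a * x * (b * x) + a * y * (b * y) ≡ a * (b * (x * x + y * y))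
        lemma = solve-∀

    norm²-along : norm² (Q ⊖ P) ≡ K * (K * N)
    norm²-along = trans (cong (λ w → dot w (Q ⊖ P)) along) (dot-along K)

    point : ℕ → Pt
    point j = P ⊕ + j · u

    onSeg⇒point : ∀ {X} → OnSeg P Q X → ∃ λ j → j ℕ.≤ suc k × point j ≡ X
    onSeg⇒point {X} (collinear , lower , upper) = from-natural (natural 0≤t t≤K)
      where
      w : Pt
      w = X ⊖ P
      uw≡0 : det u w ≡ + 0
      uw≡0 = +suc*i≡0⇒i≡0 k (begin
        K * det u w           ≡⟨ sym (det-·ˡ K u w) ⟩
        det (K · u) w         ≡⟨ cong (λ v → det v w) (sym along) ⟩
        det (Q ⊖ P) w         ≡⟨ collinear ⟩
        + 0                   ∎)
      t : ℤ
      t = det u f * det w f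
      w≡ : w ≡ t · u
      w≡ = parallel⇒multiple u f w unit uw≡0
      dot≡ : dot w (Q ⊖ P) ≡ t * (K * N)
      dot≡ = trans (cong (λ v → dot v (Q ⊖ P)) w≡) (dot-along t)
      0≤t : + 0 ℤ.≤ t
      0≤t = ℤP.*-cancelʳ-≤-pos (+ 0) t (K * N) (subst (+ 0 ℤ.≤_) dot≡ lower)
      t≤K : t ℤ.≤ K
      t≤K = ℤP.*-cancelʳ-≤-pos t K (K * N) (subst₂ ℤ._≤_ dot≡ norm²-along upper)
      natural : ∀ {i} → + 0 ℤ.≤ i → i ℤ.≤ K → ∃ λ j → j ℕ.≤ suc k × i ≡ + j
      natural {+ j} _ (+≤+ j≤) = j , j≤ , refl
      from-natural : (∃ λ j → j ℕ.≤ suc k × t ≡ + j) → ∃ λ j → j ℕ.≤ suc k × point j ≡ X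
      from-natural (j , j≤ , t≡j) = j , j≤ , ⊖-cancelʳ (begin
        point j ⊖ P     ≡⟨ ⊕-⊖ P (+ j · u) ⟩
        + j · u         ≡⟨ cong (_· u) (sym t≡j) ⟩
        t · u           ≡⟨ sym w≡ ⟩
        X ⊖ P           ∎)

    point⇒onSeg : ∀ j → j ℕ.≤ suc k → OnSeg P Q (point j)
    point⇒onSeg j j≤ = collinear , lower , upper
      where
      w≡ : point j ⊖ P ≡ + j · u
      w≡ = ⊕-⊖ P (+ j · u)
      dot≡ : dot (point j ⊖ P) (Q ⊖ P) ≡ + j * (K * N)
      dot≡ = trans (cong (λ v → dot v (Q ⊖ P)) w≡) (dot-along (+ j))
      collinear : det (Q ⊖ P) (point j ⊖ P) ≡ + 0
      collinear = begin
        det (Q ⊖ P) (point j ⊖ P)   ≡⟨ cong₂ det along w≡ ⟩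
        det (K · u) (+ j · u)       ≡⟨ det-·ˡ K u (+ j · u) ⟩
        K * det u (+ j · u)         ≡⟨ cong (K *_) (det-·ʳ-self (+ j) u) ⟩
        K * + 0                     ≡⟨ ℤP.*-zeroʳ K ⟩
        + 0                         ∎
      lower : + 0 ℤ.≤ dot (point j ⊖ P) (Q ⊖ P)
      lower = subst (+ 0 ℤ.≤_) (trans (ℤP.pos-* j _) (sym dot≡)) (+≤+ z≤n)
      upper : dot (point j ⊖ P) (Q ⊖ P) ℤ.≤ norm² (Q ⊖ P)
      upper = subst₂ ℤ._≤_ (sym dot≡) (sym norm²-along) (ℤP.*-monoʳ-≤-nonNeg (K * N) (+≤+ j≤))

    points : List Pt
    points = map point (upTo (suc (suc k)))

    ∈points⇔onSeg : ∀ {X} → X ∈ points ⇔ OnSeg P Q X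
    ∈points⇔onSeg = mk⇔ from-points to-points
      where
      from-points : ∀ {X} → X ∈ points → OnSeg P Q X
      from-points X∈ with ∈-map⁻ point X∈
      ... | j , j∈ , refl = point⇒onSeg j (ℕP.≤-pred (∈-upTo⁻ j∈))
      to-points : ∀ {X} → OnSeg P Q X → X ∈ points
      to-points onSeg =
        let j , j≤ , point≡X = onSeg⇒point onSeg in
        subst (_∈ points) point≡X (∈-map⁺ point (∈-upTo⁺ (s≤s j≤)))

    points-unique : Unique points
    points-unique = map⁺ point-injective (upTo⁺ (suc (suc k)))
      where
      point-injective : ∀ {j j'} → point j ≡ point j' → j ≡ j'
      point-injective {j} {j'} eq = ℤP.+-injective (·-cancelʳ-unimodular u f unit (begin
        + j · u         ≡⟨ sym (⊕-⊖ P (+ j · u)) ⟩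
        point j ⊖ P     ≡⟨ cong (_⊖ P) eq ⟩
        point j' ⊖ P    ≡⟨ ⊕-⊖ P (+ j' · u) ⟩
        + j' · u        ∎))

    lattice-length : ∀ {ℓ} → LL P Q ℓ → ℓ ≡ suc k
    lattice-length {ℓ} (L , L-unique , length≡ , members) = ℕP.suc-injective (begin
      suc ℓ                        ≡⟨ sym length≡ ⟩
      length L                     ≡⟨ ↭-length (∼bag⇒↭ (unique∧set⇒bag L-unique points-unique same-members)) ⟩
      length points                ≡⟨ length-map point (upTo (suc (suc k))) ⟩
      length (upTo (suc (suc k)))  ≡⟨ length-upTo (suc (suc k)) ⟩
      suc (suc k)                  ∎)
      where
      same-members : ∀ {X} → X ∈ L ⇔ X ∈ points
      same-members {X} = mk⇔
        (λ X∈L → Equivalence.from ∈points⇔onSeg (proj₁ (members X) X∈L))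
        (λ X∈points → proj₂ (members X) (Equivalence.to ∈points⇔onSeg X∈points))

  primitive-multiple : ∀ v u f {k k'} → Primitive v → + suc k' · v ≡ + suc k · u → IsUnit (det u f) → k' ≡ k
  primitive-multiple v u f {k} {k'} v-primitive k'v≡ku unit = ℕP.suc-injective (begin
    suc k'                  ≡⟨ sym (ℕP.*-identityʳ (suc k')) ⟩
    suc k' ℕ.* 1            ≡⟨ cong (suc k' ℕ.*_) (sym (v-primitive m u v≡mu)) ⟩
    suc k' ℕ.* ∣ m ∣        ≡⟨ sym (ℤP.abs-* (+ suc k') m) ⟩
    ∣ + suc k' * m ∣        ≡⟨ cong ∣_∣ k'm≡k ⟩
    suc k                   ∎)
    where
    uv≡0 : det u v ≡ + 0
    uv≡0 = +suc*i≡0⇒i≡0 k' (begin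
      + suc k' * det u v       ≡⟨ sym (det-·ʳ (+ suc k') u v) ⟩
      det u (+ suc k' · v)     ≡⟨ cong (det u) k'v≡ku ⟩
      det u (+ suc k · u)      ≡⟨ det-·ʳ-self (+ suc k) u ⟩
      + 0                      ∎)
    m : ℤ
    m = det u f * det v f
    v≡mu : v ≡ m · u
    v≡mu = parallel⇒multiple u f v unit uv≡0
    k'm≡k : + suc k' * m ≡ + suc k
    k'm≡k = ·-cancelʳ-unimodular u f unit (begin
      (+ suc k' * m) · u       ≡⟨ sym (·-assoc (+ suc k') m u) ⟩
      + suc k' · (m · u)       ≡⟨ cong (+ suc k' ·_) (sym v≡mu) ⟩
      + suc k' · v             ≡⟨ k'v≡ku ⟩
      + suc k · u              ∎)

  -- Lattice sine

  -- In LSin, v₂ = x₁ v₁ + s (D - O) with (v₁, D - O) a basis, so det v₁ v₂ = ± s, and s > 0 because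
  -- Q lies on the ray OY: lsin ∠XOY = ∣ det v₁ v₂ ∣.
  lsin-det : ∀ O X Y s → LSin O X Y s →
    ∀ k u f → X ⊖ O ≡ + suc k · u → IsUnit (det u f) →
    ∀ k' w g → Y ⊖ O ≡ + suc k' · w → IsUnit (det w g) →
    det (X ⊖ O) (Y ⊖ O) ≡ + suc k * (+ suc k' * (sgn X O Y * s))
  lsin-det O X Y s
    (v₁ , v₂ , D , p , q , x₁ , (v₁-primitive , k₁ , X≡) , (v₂-primitive , k₂ , Y≡) , basis , pq , _ , _ , v₂≡)
    k u f X-along X-unit k' w g Y-along Y-unit = begin
      det (X ⊖ O) (Y ⊖ O)            ≡⟨ det≡ ⟩
      K * (K' * (s * δ))             ≡⟨ cong (λ z → K * (K' * z)) (ℤP.*-comm s δ) ⟩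
      K * (K' * (δ * s))             ≡⟨ cong (λ z → K * (K' * (z * s))) (sym sgn≡δ) ⟩
      K * (K' * (sgn X O Y * s))     ∎
    where
    K K' δ : ℤ
    K = + suc k
    K' = + suc k'
    δ = det v₁ (D ⊖ O)
    δ-unit : IsUnit δ
    δ-unit = basis⇒unit-det basis
    v₁v₂≡ : det v₁ v₂ ≡ s * δ
    v₁v₂≡ = trans (cong (det v₁) v₂≡) (det-shear v₁ x₁ s (D ⊖ O))
    s-positive : ∃ λ m → s ≡ + suc m
    s-positive = +suc*i≡+suc⇒positive p q s (*-cancelʳ-≢0 (unit≢0 δ-unit) (begin
      + suc p * s * δ          ≡⟨ ℤP.*-assoc (+ suc p) s δ ⟩
      + suc p * (s * δ)        ≡⟨ cong (+ suc p *_) (sym v₁v₂≡) ⟩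
      + suc p * det v₁ v₂      ≡⟨ pq ⟩
      + suc q * δ              ∎))
    det≡ : det (X ⊖ O) (Y ⊖ O) ≡ K * (K' * (s * δ))
    det≡ = begin
      det (X ⊖ O) (Y ⊖ O)                     ≡⟨ cong₂ det X≡ Y≡ ⟩
      det (+ suc k₁ · v₁) (+ suc k₂ · v₂)     ≡⟨ det-·ˡ (+ suc k₁) v₁ _ ⟩
      + suc k₁ * det v₁ (+ suc k₂ · v₂)       ≡⟨ cong (+ suc k₁ *_) (det-·ʳ (+ suc k₂) v₁ v₂) ⟩
      + suc k₁ * (+ suc k₂ * det v₁ v₂)       ≡⟨ cong₂ (λ a b → + suc a * (+ suc b * det v₁ v₂)) k₁≡k k₂≡k' ⟩
      K * (K' * det v₁ v₂)                    ≡⟨ cong (λ z → K * (K' * z)) v₁v₂≡ ⟩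
      K * (K' * (s * δ))                      ∎
      where
      k₁≡k : k₁ ≡ k
      k₁≡k = primitive-multiple v₁ u f v₁-primitive (trans (sym X≡) X-along) X-unit
      k₂≡k' : k₂ ≡ k'
      k₂≡k' = primitive-multiple v₂ w g v₂-primitive (trans (sym Y≡) Y-along) Y-unit
    sgn≡δ : sgn X O Y ≡ δ
    sgn≡δ = begin
      sgnℤ (det (X ⊖ O) (Y ⊖ O))           ≡⟨ cong sgnℤ det≡ ⟩
      sgnℤ (K * (K' * (s * δ)))            ≡⟨ cong (λ z → sgnℤ (K * (K' * (z * δ)))) (proj₂ s-positive) ⟩
      sgnℤ (K * (K' * (S * δ)))            ≡⟨ cong sgnℤ (reassociate K K' S δ) ⟩
      sgnℤ (K * (K' * S) * δ)              ≡⟨ sgn-positive*unit (K * (K' * S)) δ-unit ⟩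
      δ                                    ∎
      where
      S : ℤ
      S = + suc (proj₁ s-positive)
      reassociate : ∀ a b c d → a * (b * (c * d)) ≡ a * (b * c) * d
      reassociate = solve-∀

  -- The signed length-sine sequence

  record UnitSegment (P Q V : Pt) : Set where
    field
      steps      : ℕ
      direction  : Pt
      along      : Q ⊖ P ≡ + suc steps · direction
      unimodular : IsUnit (det direction (V ⊖ P))

  unitSegment : ∀ {n} A V → UnitDist n A V → ∀ {i} → i < n → UnitSegment (A i) (A (suc i)) V
  unitSegment A V unitDist {i} i<n =
    let v , (_ , k , along) , basis = unitDist i i<n
    in record { steps = k ; direction = v ; along = along ; unimodular = basis⇒unit-det basis }

  module UnitSegmentProperties {P Q V : Pt} (S : UnitSegment P Q V) where
    open UnitSegment S public

    orientation : ℤ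
    orientation = det direction (V ⊖ P)

    area≡ : det (Q ⊖ P) (V ⊖ P) ≡ + suc steps * orientation
    area≡ = trans (cong (λ x → det x (V ⊖ P)) along) (det-·ˡ (+ suc steps) direction (V ⊖ P))

    area≢0 : det (Q ⊖ P) (V ⊖ P) ≢ + 0
    area≢0 area≡0 = unit≢0 unimodular (+suc*i≡0⇒i≡0 steps (trans (sym area≡) area≡0))

    sgn≡ : sgn P V Q ≡ orientation
    sgn≡ = trans (cong sgnℤ (trans (rotate P V Q) area≡)) (sgn-positive*unit (+ suc steps) unimodular)
      where
      rotate : ∀ P V Q → det (P ⊖ V) (Q ⊖ V) ≡ det (Q ⊖ P) (V ⊖ P)
      rotate (a , b) (c , d) (e , g) = lemma a b c d e g
        where
        lemma : ∀ a b c d e g → (a - c) * (g - d) - (b - d) * (e - c) ≡ (e - a) * (d - b) - (g - b) * (c - a)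
        lemma = solve-∀

    sgn*length≡area : ∀ {ℓ} → LL P Q ℓ → sgn P V Q * + ℓ ≡ det (Q ⊖ P) (V ⊖ P)
    sgn*length≡area {ℓ} ll = begin
      sgn P V Q * + ℓ                  ≡⟨ cong₂ (λ e ℓ → e * + ℓ) sgn≡ length≡ ⟩
      orientation * + suc steps        ≡⟨ ℤP.*-comm orientation (+ suc steps) ⟩
      + suc steps * orientation        ≡⟨ sym area≡ ⟩
      det (Q ⊖ P) (V ⊖ P)              ∎
      where
      length≡ : ℓ ≡ suc steps
      length≡ = SegmentPoints.lattice-length P Q direction (V ⊖ P) steps along unimodular ll

    reversed-along : P ⊖ Q ≡ + suc steps · (-1ℤ · direction)
    reversed-along = ⊖-swap P Q (+ suc steps) direction along

    reversed-unimodular : IsUnit (det (-1ℤ · direction) (V ⊖ P))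
    reversed-unimodular = subst IsUnit (sym (trans (det-·ˡ -1ℤ direction (V ⊖ P)) (ℤP.-1*i≡-i _)))
      (neg-unit unimodular)

  edgeDet : (ℕ → Pt) → Pt → ℕ → ℤ
  edgeDet A V i = det (A (suc i) ⊖ A i) (V ⊖ A i)

  angleDet : (ℕ → Pt) → ℕ → ℤ
  angleDet A i = det (A i ⊖ A (suc i)) (A (suc (suc i)) ⊖ A (suc i))

  edgeDet≢0 : ∀ {n} A V → UnitDist n A V → ∀ {i} → i < n → edgeDet A V i ≢ + 0
  edgeDet≢0 A V unitDist i<n = UnitSegmentProperties.area≢0 (unitSegment A V unitDist i<n)

  sls-even : ∀ {n} A V a → UnitDist n A V → SLS n A V a → ∀ {i} → i < n → a (2 ℕ.* i) ≡ edgeDet A V i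
  sls-even A V a unitDist (lengths , _) {i} i<n =
    let ℓ , ll , a≡ = lengths i i<n
    in trans a≡ (UnitSegmentProperties.sgn*length≡area (unitSegment A V unitDist i<n) ll)

  sls-odd : ∀ {n} A V a → UnitDist n A V → SLS n A V a → ∀ {i} → suc i < n →
    a (suc (2 ℕ.* i)) * (a (2 ℕ.* i) * a (2 ℕ.* suc i)) ≡ angleDet A i
  sls-odd {n} A V a unitDist sls@(_ , sines) {i} i+1<n = begin
    a (suc (2 ℕ.* i)) * (a (2 ℕ.* i) * a (2 ℕ.* suc i))
      ≡⟨ cong₂ _*_ a-odd (cong₂ _*_ (trans (sls-even A V a unitDist sls i<n) S₀.area≡)
                                    (trans (sls-even A V a unitDist sls i+1<n) S₁.area≡)) ⟩
    S₀.orientation * S₁.orientation * σ * s * ((K₀ * S₀.orientation) * (K₁ * S₁.orientation))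
      ≡⟨ units-cancel S₀.unimodular S₁.unimodular ⟩
    K₀ * (K₁ * (σ * s))
      ≡⟨ sym (lsin-det (A (suc i)) (A i) (A (suc (suc i))) s lsin
               S₀.steps (-1ℤ · S₀.direction) (V ⊖ A i) S₀.reversed-along S₀.reversed-unimodular
               S₁.steps S₁.direction (V ⊖ A (suc i)) S₁.along S₁.unimodular) ⟩
    angleDet A i
      ∎
    where
    i<n : i < n
    i<n = ℕP.<⇒≤ i+1<n
    module S₀ = UnitSegmentProperties (unitSegment A V unitDist i<n)
    module S₁ = UnitSegmentProperties (unitSegment A V unitDist i+1<n)
    K₀ K₁ σ s : ℤ
    K₀ = + suc S₀.steps
    K₁ = + suc S₁.steps
    σ = sgn (A i) (A (suc i)) (A (suc (suc i)))
    s = proj₁ (sines i i+1<n)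
    lsin : LSin (A (suc i)) (A i) (A (suc (suc i))) s
    lsin = proj₁ (proj₂ (sines i i+1<n))
    a-odd : a (suc (2 ℕ.* i)) ≡ S₀.orientation * S₁.orientation * σ * s
    a-odd = trans (proj₂ (proj₂ (sines i i+1<n))) (cong₂ (λ e₀ e₁ → e₀ * e₁ * σ * s) S₀.sgn≡ S₁.sgn≡)
    units-cancel : ∀ {e₀ e₁} → IsUnit e₀ → IsUnit e₁ →
      e₀ * e₁ * σ * s * ((K₀ * e₀) * (K₁ * e₁)) ≡ K₀ * (K₁ * (σ * s))
    units-cancel {e₀} {e₁} unit₀ unit₁ = begin
      e₀ * e₁ * σ * s * ((K₀ * e₀) * (K₁ * e₁))
        ≡⟨ regroup e₀ e₁ σ s K₀ K₁ ⟩
      (e₀ * e₀) * (e₁ * e₁) * (K₀ * (K₁ * (σ * s)))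
        ≡⟨ cong₂ (λ x y → x * y * (K₀ * (K₁ * (σ * s)))) (unit*unit≡1 unit₀) (unit*unit≡1 unit₁) ⟩
      + 1 * + 1 * (K₀ * (K₁ * (σ * s)))
        ≡⟨ ℤP.*-identityˡ _ ⟩
      K₀ * (K₁ * (σ * s))
        ∎
      where
      regroup : ∀ e₀ e₁ σ s K₀ K₁ →
        e₀ * e₁ * σ * s * ((K₀ * e₀) * (K₁ * e₁)) ≡ (e₀ * e₀) * (e₁ * e₁) * (K₀ * (K₁ * (σ * s)))
      regroup = solve-∀

  SameInvariants : ℕ → (ℕ → Pt) → Pt → (ℕ → Pt) → Pt → Set
  SameInvariants n A V B W =
    (∀ i → i < n → edgeDet A V i ≡ edgeDet B W i) × (∀ i → suc i < n → angleDet A i ≡ angleDet B i)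

  data EvenOdd : ℕ → Set where
    even : ∀ i → EvenOdd (2 ℕ.* i)
    odd  : ∀ i → EvenOdd (suc (2 ℕ.* i))

  evenOdd : ∀ k → EvenOdd k
  evenOdd zero = even 0
  evenOdd (suc k) with evenOdd k
  ... | even i = odd i
  ... | odd i  = subst EvenOdd (ℕP.*-suc 2 i) (even (suc i))

  <∸1⇔suc< : ∀ {k m} → k < m ∸ 1 ⇔ suc k < m
  <∸1⇔suc< {m = zero}  = mk⇔ (λ ()) (λ ())
  <∸1⇔suc< {m = suc m} = mk⇔ s≤s ℕP.≤-pred

  even-bound : ∀ {i n} → 2 ℕ.* i < 2 ℕ.* n ∸ 1 ⇔ i < n
  even-bound {i} {n} = mk⇔
    (λ 2i< → ℕP.*-cancelˡ-≤ 2 (subst (ℕ._≤ 2 ℕ.* n) (sym (ℕP.*-suc 2 i)) (Equivalence.to <∸1⇔suc< 2i<)))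
    (λ i<n → Equivalence.from <∸1⇔suc< (subst (ℕ._≤ 2 ℕ.* n) (ℕP.*-suc 2 i) (ℕP.*-monoʳ-≤ 2 i<n)))

  odd-bound : ∀ {i n} → suc (2 ℕ.* i) < 2 ℕ.* n ∸ 1 ⇔ suc i < n
  odd-bound {i} {n} = mk⇔
    (λ 2i+1< → ℕP.*-cancelˡ-< 2 (suc i) n (subst (ℕ._< 2 ℕ.* n) (sym (ℕP.*-suc 2 i)) (Equivalence.to <∸1⇔suc< 2i+1<)))
    (λ i+1<n → Equivalence.from <∸1⇔suc< (subst (ℕ._< 2 ℕ.* n) (ℕP.*-suc 2 i) (ℕP.*-monoʳ-< 2 i+1<n)))

  sls≡⇔same-invariants : ∀ {n} A V a B W b → UnitDist n A V → UnitDist n B W → SLS n A V a → SLS n B W b →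
    (∀ k → k < 2 ℕ.* n ∸ 1 → a k ≡ b k) ⇔ SameInvariants n A V B W
  sls≡⇔same-invariants {n} A V a B W b unitDistA unitDistB slsA slsB = mk⇔ to from
    where
    evenA : ∀ {i} → i < n → a (2 ℕ.* i) ≡ edgeDet A V i
    evenA = sls-even A V a unitDistA slsA
    evenB : ∀ {i} → i < n → b (2 ℕ.* i) ≡ edgeDet B W i
    evenB = sls-even B W b unitDistB slsB
    oddA : ∀ {i} → suc i < n → a (suc (2 ℕ.* i)) * (a (2 ℕ.* i) * a (2 ℕ.* suc i)) ≡ angleDet A i
    oddA = sls-odd A V a unitDistA slsA
    oddB : ∀ {i} → suc i < n → b (suc (2 ℕ.* i)) * (b (2 ℕ.* i) * b (2 ℕ.* suc i)) ≡ angleDet B i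
    oddB = sls-odd B W b unitDistB slsB

    to : (∀ k → k < 2 ℕ.* n ∸ 1 → a k ≡ b k) → SameInvariants n A V B W
    to a≡b = edges , angles
      where
      a≡b-even : ∀ {i} → i < n → a (2 ℕ.* i) ≡ b (2 ℕ.* i)
      a≡b-even i<n = a≡b _ (Equivalence.from even-bound i<n)
      edges : ∀ i → i < n → edgeDet A V i ≡ edgeDet B W i
      edges i i<n = trans (sym (evenA i<n)) (trans (a≡b-even i<n) (evenB i<n))
      angles : ∀ i → suc i < n → angleDet A i ≡ angleDet B i
      angles i i+1<n = begin
        angleDet A i                                           ≡⟨ sym (oddA i+1<n) ⟩
        a (suc (2 ℕ.* i)) * (a (2 ℕ.* i) * a (2 ℕ.* suc i))
          ≡⟨ cong₂ _*_ (a≡b _ (Equivalence.from odd-bound i+1<n))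
                       (cong₂ _*_ (a≡b-even (ℕP.<⇒≤ i+1<n)) (a≡b-even i+1<n)) ⟩
        b (suc (2 ℕ.* i)) * (b (2 ℕ.* i) * b (2 ℕ.* suc i))   ≡⟨ oddB i+1<n ⟩
        angleDet B i                                           ∎

    from : SameInvariants n A V B W → ∀ k → k < 2 ℕ.* n ∸ 1 → a k ≡ b k
    from (edges , angles) k = agree (evenOdd k)
      where
      agree : ∀ {k} → EvenOdd k → k < 2 ℕ.* n ∸ 1 → a k ≡ b k
      agree (even i) 2i< = trans (evenA i<n) (trans (edges i i<n) (sym (evenB i<n)))
        where
        i<n : i < n
        i<n = Equivalence.to even-bound 2i<
      agree (odd i) 2i+1< = *-cancelʳ-≢0 (*-≢0 (edgeDet≢0 A V unitDistA i<n) (edgeDet≢0 A V unitDistA i+1<n)) (begin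
        a (suc (2 ℕ.* i)) * (edgeDet A V i * edgeDet A V (suc i))
          ≡⟨ cong (a (suc (2 ℕ.* i)) *_) (sym (cong₂ _*_ (evenA i<n) (evenA i+1<n))) ⟩
        a (suc (2 ℕ.* i)) * (a (2 ℕ.* i) * a (2 ℕ.* suc i))   ≡⟨ oddA i+1<n ⟩
        angleDet A i                                           ≡⟨ angles i i+1<n ⟩
        angleDet B i                                           ≡⟨ sym (oddB i+1<n) ⟩
        b (suc (2 ℕ.* i)) * (b (2 ℕ.* i) * b (2 ℕ.* suc i))
          ≡⟨ cong (b (suc (2 ℕ.* i)) *_) (cong₂ _*_ (trans (evenB i<n) (sym (edges i i<n)))
                                                     (trans (evenB i+1<n) (sym (edges (suc i) i+1<n)))) ⟩
        b (suc (2 ℕ.* i)) * (edgeDet A V i * edgeDet A V (suc i)) ∎)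
        where
        i+1<n : suc i < n
        i+1<n = Equivalence.to odd-bound 2i+1<
        i<n : i < n
        i<n = ℕP.<⇒≤ i+1<n

  -- Proper lattice-affine maps

  det-apply : ∀ ξ → Proper ξ → ∀ p q r s →
    det (apply ξ p ⊖ apply ξ q) (apply ξ r ⊖ apply ξ s) ≡ det (p ⊖ q) (r ⊖ s)
  det-apply (aff a b c d e g) proper (p₁ , p₂) (q₁ , q₂) (r₁ , r₂) (s₁ , s₂) =
    trans (expand a b c d e g p₁ p₂ q₁ q₂ r₁ r₂ s₁ s₂)
          (trans (cong (_* det (p₁ - q₁ , p₂ - q₂) (r₁ - s₁ , r₂ - s₂)) proper) (ℤP.*-identityˡ _))
    where
    expand : ∀ a b c d e g p₁ p₂ q₁ q₂ r₁ r₂ s₁ s₂ →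
      ((a * p₁ + b * p₂ + e) - (a * q₁ + b * q₂ + e)) * ((c * r₁ + d * r₂ + g) - (c * s₁ + d * s₂ + g))
        - ((c * p₁ + d * p₂ + g) - (c * q₁ + d * q₂ + g)) * ((a * r₁ + b * r₂ + e) - (a * s₁ + b * s₂ + e))
        ≡ (a * d - b * c) * ((p₁ - q₁) * (r₂ - s₂) - (p₂ - q₂) * (r₁ - s₁))
    expand = solve-∀

  image-determined : ∀ ξ → Proper ξ → ∀ P Q R X {P' Q' R' X'} →
    apply ξ P ≡ P' → apply ξ Q ≡ Q' → apply ξ R ≡ R' →
    det (Q' ⊖ P') (R' ⊖ P') ≢ + 0 →
    det (P ⊖ Q) (X ⊖ Q) ≡ det (P' ⊖ Q') (X' ⊖ Q') →
    det (X ⊖ Q) (R ⊖ Q) ≡ det (X' ⊖ Q') (R' ⊖ Q') →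
    apply ξ X ≡ X'
  image-determined ξ proper P Q R X refl refl refl nondegenerate angle≡ edge≡ =
    ⊖-cancelʳ (det-injective (apply ξ P ⊖ apply ξ Q) (apply ξ R ⊖ apply ξ Q)
      (λ det≡0 → nondegenerate (trans (rebase (apply ξ P) (apply ξ Q) (apply ξ R)) (cong -_ det≡0)))
      (trans (det-apply ξ proper P Q X Q) angle≡)
      (trans (det-apply ξ proper X Q R Q) edge≡))
    where
    rebase : ∀ P Q R → det (Q ⊖ P) (R ⊖ P) ≡ - det (P ⊖ Q) (R ⊖ Q)
    rebase (a , b) (c , d) (e , g) = lemma a b c d e g
      where
      lemma : ∀ a b c d e g → (c - a) * (g - b) - (d - b) * (e - a) ≡ - ((a - c) * (g - d) - (b - d) * (e - c))
      lemma = solve-∀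

  -- x ↦ Q + ε (det (x - P) f · u' + det u (x - P) · f') with ε = det u f = ±1: by Cramer's rule
  -- this is the affine map sending P, P + u, P + f to Q, Q + u', Q + f'.
  frameMap : (P u f Q u' f' : Pt) → Aff
  frameMap (P₁ , P₂) (u₁ , u₂) (f₁ , f₂) (Q₁ , Q₂) (u₁' , u₂') (f₁' , f₂') =
    aff m₁₁ m₁₂ m₂₁ m₂₂ (Q₁ - (m₁₁ * P₁ + m₁₂ * P₂)) (Q₂ - (m₂₁ * P₁ + m₂₂ * P₂))
    where
    ε m₁₁ m₁₂ m₂₁ m₂₂ : ℤ
    ε = u₁ * f₂ - u₂ * f₁
    m₁₁ = ε * (f₂ * u₁' - u₂ * f₁')
    m₁₂ = ε * (u₁ * f₁' - f₁ * u₁')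
    m₂₁ = ε * (f₂ * u₂' - u₂ * f₂')
    m₂₂ = ε * (u₁ * f₂' - f₁ * u₂')

  frameMap-proper : ∀ P u f Q u' f' → IsUnit (det u f) → det u' f' ≡ det u f → Proper (frameMap P u f Q u' f')
  frameMap-proper _ (u₁ , u₂) (f₁ , f₂) _ (u₁' , u₂') (f₁' , f₂') unit ε'≡ε =
    trans (expand u₁ u₂ f₁ f₂ u₁' u₂' f₁' f₂')
      (trans (cong (λ e → ε * ε * (ε * e)) ε'≡ε) (cong₂ _*_ (unit*unit≡1 unit) (unit*unit≡1 unit)))
    where
    ε : ℤ
    ε = u₁ * f₂ - u₂ * f₁
    expand : ∀ u₁ u₂ f₁ f₂ u₁' u₂' f₁' f₂' → let ε = u₁ * f₂ - u₂ * f₁ in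
      ε * (f₂ * u₁' - u₂ * f₁') * (ε * (u₁ * f₂' - f₁ * u₂')) - ε * (u₁ * f₁' - f₁ * u₁') * (ε * (f₂ * u₂' - u₂ * f₂'))
        ≡ ε * ε * (ε * (u₁' * f₂' - u₂' * f₁'))
    expand = solve-∀

  frameMap-base : ∀ P u f Q u' f' → apply (frameMap P u f Q u' f') P ≡ Q
  frameMap-base (P₁ , P₂) (u₁ , u₂) (f₁ , f₂) (Q₁ , Q₂) (u₁' , u₂') (f₁' , f₂') =
    cong₂ _,_ (cancel (ε * (f₂ * u₁' - u₂ * f₁')) (ε * (u₁ * f₁' - f₁ * u₁')) P₁ P₂ Q₁)
              (cancel (ε * (f₂ * u₂' - u₂ * f₂')) (ε * (u₁ * f₂' - f₁ * u₂')) P₁ P₂ Q₂)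
    where
    ε : ℤ
    ε = u₁ * f₂ - u₂ * f₁
    cancel : ∀ m n P₁ P₂ Q → m * P₁ + n * P₂ + (Q - (m * P₁ + n * P₂)) ≡ Q
    cancel = solve-∀

  frameMap-⊖ : ∀ P u f Q u' f' x →
    apply (frameMap P u f Q u' f') x ⊖ Q ≡ det u f · (det (x ⊖ P) f · u' ⊕ det u (x ⊖ P) · f')
  frameMap-⊖ (P₁ , P₂) (u₁ , u₂) (f₁ , f₂) (Q₁ , Q₂) (u₁' , u₂') (f₁' , f₂') (x₁ , x₂) =
    cong₂ _,_ (expand u₁ u₂ f₁ f₂ u₁' f₁' P₁ P₂ Q₁ x₁ x₂) (expand u₁ u₂ f₁ f₂ u₂' f₂' P₁ P₂ Q₂ x₁ x₂)
    where
    expand : ∀ u₁ u₂ f₁ f₂ a b P₁ P₂ Q x₁ x₂ → let ε = u₁ * f₂ - u₂ * f₁ in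
      ε * (f₂ * a - u₂ * b) * x₁ + ε * (u₁ * b - f₁ * a) * x₂
        + (Q - (ε * (f₂ * a - u₂ * b) * P₁ + ε * (u₁ * b - f₁ * a) * P₂)) - Q
        ≡ ε * (((x₁ - P₁) * f₂ - (x₂ - P₂) * f₁) * a + (u₁ * (x₂ - P₂) - u₂ * (x₁ - P₁)) * b)
    expand = solve-∀

  frameMap-along : ∀ P u f Q u' f' x c → IsUnit (det u f) → x ⊖ P ≡ c · u →
    apply (frameMap P u f Q u' f') x ⊖ Q ≡ c · u'
  frameMap-along P u f Q u' f' x c unit x⊖P≡cu = begin
    apply (frameMap P u f Q u' f') x ⊖ Q            ≡⟨ frameMap-⊖ P u f Q u' f' x ⟩
    ε · (det (x ⊖ P) f · u' ⊕ det u (x ⊖ P) · f')   ≡⟨ cong (λ y → ε · (det y f · u' ⊕ det u y · f')) x⊖P≡cu ⟩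
    ε · (det (c · u) f · u' ⊕ det u (c · u) · f')   ≡⟨ collapse u f u' f' ⟩
    (ε * ε * c) · u'                                ≡⟨ cong (λ e → (e * c) · u') (unit*unit≡1 unit) ⟩
    (+ 1 * c) · u'                                  ≡⟨ cong (_· u') (ℤP.*-identityˡ c) ⟩
    c · u'                                          ∎
    where
    ε : ℤ
    ε = det u f
    collapse : ∀ u f u' f' → det u f · (det (c · u) f · u' ⊕ det u (c · u) · f') ≡ (det u f * det u f * c) · u'
    collapse (u₁ , u₂) (f₁ , f₂) (u₁' , u₂') (f₁' , f₂') =
      cong₂ _,_ (identity u₁ u₂ f₁ f₂ c u₁' f₁') (identity u₁ u₂ f₁ f₂ c u₂' f₂')
      where
      identity : ∀ u₁ u₂ f₁ f₂ c a b → let ε = u₁ * f₂ - u₂ * f₁ in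
        ε * ((c * u₁ * f₂ - c * u₂ * f₁) * a + (u₁ * (c * u₂) - u₂ * (c * u₁)) * b) ≡ ε * ε * c * a
      identity = solve-∀

  frameMap-across : ∀ P u f Q u' f' x → IsUnit (det u f) → x ⊖ P ≡ f →
    apply (frameMap P u f Q u' f') x ⊖ Q ≡ f'
  frameMap-across P u f Q u' f' x unit x⊖P≡f = begin
    apply (frameMap P u f Q u' f') x ⊖ Q            ≡⟨ frameMap-⊖ P u f Q u' f' x ⟩
    ε · (det (x ⊖ P) f · u' ⊕ det u (x ⊖ P) · f')   ≡⟨ cong (λ y → ε · (det y f · u' ⊕ det u y · f')) x⊖P≡f ⟩
    ε · (det f f · u' ⊕ ε · f')                     ≡⟨ collapse u f u' f' ⟩
    (ε * ε) · f'                                    ≡⟨ cong (_· f') (unit*unit≡1 unit) ⟩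
    + 1 · f'                                        ≡⟨ ·-identityˡ f' ⟩
    f'                                              ∎
    where
    ε : ℤ
    ε = det u f
    collapse : ∀ u f u' f' → det u f · (det f f · u' ⊕ det u f · f') ≡ (det u f * det u f) · f'
    collapse (u₁ , u₂) (f₁ , f₂) (u₁' , u₂') (f₁' , f₂') =
      cong₂ _,_ (identity u₁ u₂ f₁ f₂ u₁' f₁') (identity u₁ u₂ f₁ f₂ u₂' f₂')
      where
      identity : ∀ u₁ u₂ f₁ f₂ a b → let ε = u₁ * f₂ - u₂ * f₁ in
        ε * ((f₁ * f₂ - f₂ * f₁) * a + ε * b) ≡ ε * ε * b
      identity = solve-∀
    ·-identityˡ : ∀ x → + 1 · x ≡ x
    ·-identityˡ (a , b) = cong₂ _,_ (ℤP.*-identityˡ a) (ℤP.*-identityˡ b)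

  -- Congruence of broken lines

  Congruent : ℕ → (ℕ → Pt) → Pt → (ℕ → Pt) → Pt → Set
  Congruent n A V B W = ∃ λ ξ → Proper ξ × (apply ξ V ≡ W) × (∀ i → i ≤ n → apply ξ (A i) ≡ B i)

  congruent⇒same-invariants : ∀ {n} A V B W → Congruent n A V B W → SameInvariants n A V B W
  congruent⇒same-invariants {n} A V B W (ξ , proper , V↦W , A↦B) = edges , angles
    where
    transport : ∀ p q r s {p' q' r' s'} →
      apply ξ p ≡ p' → apply ξ q ≡ q' → apply ξ r ≡ r' → apply ξ s ≡ s' →
      det (p ⊖ q) (r ⊖ s) ≡ det (p' ⊖ q') (r' ⊖ s')
    transport p q r s refl refl refl refl = sym (det-apply ξ proper p q r s)
    edges : ∀ i → i < n → edgeDet A V i ≡ edgeDet B W i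
    edges i i<n = transport (A (suc i)) (A i) V (A i) (A↦B (suc i) i<n) (A↦B i (ℕP.<⇒≤ i<n)) V↦W (A↦B i (ℕP.<⇒≤ i<n))
    angles : ∀ i → suc i < n → angleDet A i ≡ angleDet B i
    angles i i+1<n = transport (A i) (A (suc i)) (A (suc (suc i))) (A (suc i))
      (A↦B i i≤n) (A↦B (suc i) i+1≤n) (A↦B (suc (suc i)) i+1<n) (A↦B (suc i) i+1≤n)
      where
      i+1≤n : suc i ≤ n
      i+1≤n = ℕP.<⇒≤ i+1<n
      i≤n : i ≤ n
      i≤n = ℕP.≤-trans (ℕP.n≤1+n i) i+1≤n

  same-invariants⇒congruent : ∀ {n} A V B W → 1 ≤ n → UnitDist n A V → UnitDist n B W →
    SameInvariants n A V B W → Congruent n A V B W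
  same-invariants⇒congruent {n} A V B W 1≤n unitDistA unitDistB (edges , angles) = ξ , proper , V↦W , A↦B
    where
    module S = UnitSegmentProperties (unitSegment A V unitDistA 1≤n)
    module T = UnitSegmentProperties (unitSegment B W unitDistB 1≤n)
    ξ : Aff
    ξ = frameMap (A 0) S.direction (V ⊖ A 0) (B 0) T.direction (W ⊖ B 0)
    first-edge : + suc S.steps * S.orientation ≡ + suc T.steps * T.orientation
    first-edge = trans (sym S.area≡) (trans (edges 0 1≤n) T.area≡)
    same-orientation : T.orientation ≡ S.orientation
    same-orientation = begin
      T.orientation                          ≡⟨ sym (sgn-positive*unit (+ suc T.steps) T.unimodular) ⟩
      sgnℤ (+ suc T.steps * T.orientation)   ≡⟨ cong sgnℤ (sym first-edge) ⟩
      sgnℤ (+ suc S.steps * S.orientation)   ≡⟨ sgn-positive*unit (+ suc S.steps) S.unimodular ⟩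
      S.orientation                          ∎
    same-steps : S.steps ≡ T.steps
    same-steps = ℕP.suc-injective (begin
      suc S.steps                            ≡⟨ sym (∣+suc*unit∣ S.steps S.unimodular) ⟩
      ∣ + suc S.steps * S.orientation ∣      ≡⟨ cong ∣_∣ first-edge ⟩
      ∣ + suc T.steps * T.orientation ∣      ≡⟨ ∣+suc*unit∣ T.steps T.unimodular ⟩
      suc T.steps                            ∎)
    proper : Proper ξ
    proper = frameMap-proper (A 0) S.direction (V ⊖ A 0) (B 0) T.direction (W ⊖ B 0) S.unimodular same-orientation
    A₀↦B₀ : apply ξ (A 0) ≡ B 0
    A₀↦B₀ = frameMap-base (A 0) S.direction (V ⊖ A 0) (B 0) T.direction (W ⊖ B 0)
    V↦W : apply ξ V ≡ W
    V↦W = ⊖-cancelʳ (frameMap-across (A 0) S.direction (V ⊖ A 0) (B 0) T.direction (W ⊖ B 0) V S.unimodular refl)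
    A₁↦B₁ : apply ξ (A 1) ≡ B 1
    A₁↦B₁ = ⊖-cancelʳ (begin
      apply ξ (A 1) ⊖ B 0      ≡⟨ frameMap-along (A 0) S.direction (V ⊖ A 0) (B 0) T.direction (W ⊖ B 0)
                                     (A 1) (+ suc S.steps) S.unimodular S.along ⟩
      + suc S.steps · T.direction ≡⟨ cong (λ k → + suc k · T.direction) same-steps ⟩
      + suc T.steps · T.direction ≡⟨ sym T.along ⟩
      B 1 ⊖ B 0                ∎)
    consecutive : ∀ i → i < n → apply ξ (A i) ≡ B i × apply ξ (A (suc i)) ≡ B (suc i)
    consecutive zero    _      = A₀↦B₀ , A₁↦B₁
    consecutive (suc i) i+1<n  =
      let Aᵢ↦Bᵢ , Aᵢ₊₁↦Bᵢ₊₁ = consecutive i i<n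
      in Aᵢ₊₁↦Bᵢ₊₁ , image-determined ξ proper (A i) (A (suc i)) V (A (suc (suc i))) Aᵢ↦Bᵢ Aᵢ₊₁↦Bᵢ₊₁ V↦W
                       (edgeDet≢0 B W unitDistB i<n) (angles i i+1<n) (edges (suc i) i+1<n)
      where
      i<n : i < n
      i<n = ℕP.<⇒≤ i+1<n
    A↦B : ∀ i → i ≤ n → apply ξ (A i) ≡ B i
    A↦B zero    _   = A₀↦B₀
    A↦B (suc i) i<n = proj₂ (consecutive i i<n)

open BrokenLineCongruence
open import Data.Nat using (ℕ; _<_; _≤_; _*_; _∸_)
open import Data.Integer using (ℤ)
open import Data.Product using (∃; _×_; _,_)
open import Function.Bundles using (_⇔_; mk⇔; Equivalence)
open import Function.Base using (_∘_)
open import Relation.Binary.PropositionalEquality using (_≡_)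

theorem3p4 : (n : ℕ) (A B : ℕ → Pt) (V₁ V₂ : Pt) (a b : ℕ → ℤ) →
    BrokenLine n A → UnitDist n A V₁ →
    BrokenLine n B → UnitDist n B V₂ →
    SLS n A V₁ a → SLS n B V₂ b →
    ((∀ k → k < 2 * n ∸ 1 → a k ≡ b k) ⇔
     ∃ λ ξ → Proper ξ × (apply ξ V₁ ≡ V₂) × (∀ i → i ≤ n → apply ξ (A i) ≡ B i))
theorem3p4 n A B V₁ V₂ a b (1≤n , _) unitDistA _ unitDistB slsA slsB =
  mk⇔ (same-invariants⇒congruent A V₁ B V₂ 1≤n unitDistA unitDistB ∘ Equivalence.to sequences-agree)
      (Equivalence.from sequences-agree ∘ congruent⇒same-invariants A V₁ B V₂)
  where
  sequences-agree : (∀ k → k < 2 * n ∸ 1 → a k ≡ b k) ⇔ SameInvariants n A V₁ B V₂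
  sequences-agree = sls≡⇔same-invariants A V₁ a B V₂ b unitDistA unitDistB slsA slsB
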